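{- If $n$ is a positive integer, then $T(2n)\supseteq T(n)$.
   Context: For an integer $n$, a Toda prime of $n$ is an odd prime $p$ such that $p-1\mid 4n$ and $\gcd\!\left(p,\frac{4n}{p-1}\right)=1$. $T(n)$ denotes the set of Toda primes of $n$. -}

module Defs where

open import Data.Nat using (ℕ; _*_; _∸_)
open import Data.Nat.Primality using (Prime)
open import Data.Nat.Divisibility using (_∣_)
open import Data.Nat.Coprimality using (Coprime)
open import Data.Nat.Properties using ()
open import Data.Product using (_×_; ∃-syntax)
open import Relation.Binary.PropositionalEquality using (_≡_)
open import Relation.Nullary using (¬_)

-- p is a Toda prime of n: p is an odd prime, (p - 1) ∣ 4n, and
-- gcd(p, 4n/(p-1)) = 1.  The quotient 4n/(p-1) is written as the
-- (unique, since p - 1 ≥ 2) k with 4n ≡ (p - 1) * k.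
TodaPrime : ℕ → ℕ → Set
TodaPrime n p =
  Prime p × ¬ (2 ∣ p) × (p ∸ 1) ∣ (4 * n) ×
  (∃[ k ] ((4 * n ≡ (p ∸ 1) * k) × Coprime p k))

{-# OPTIONS --safe #-}
-- Replacing n by c n multiplies the quotient 4n/(p-1) by c, which keeps it
-- coprime to p whenever gcd(p, c) = 1; for c = 2 this holds as p is odd.
module Submission where

open import Data.Nat using (ℕ; _*_; _∸_; _<_)
open import Data.Nat.Coprimality using (Coprime; coprime-factors) renaming (sym to coprime-sym)
open import Data.Nat.Divisibility using (_∣_; _∤_; ∣-trans; m∣m*n)
open import Data.Nat.Primality using (Prime; prime[2]; prime⇒irreducible)
open import Data.Nat.Properties using (*-commutativeSemigroup)
open import Algebra.Properties.CommutativeSemigroup *-commutativeSemigroup using (x∙yz≈y∙xz)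
open import Data.Product using (_,_)
open import Data.Sum using (inj₁; inj₂)
open import Relation.Binary.PropositionalEquality using (_≡_; refl; sym; cong; subst; module ≡-Reasoning)
open import Relation.Nullary using (contradiction)

open import Defs

prime∤⇒coprime : ∀ {p n} → Prime p → p ∤ n → Coprime p n
prime∤⇒coprime pp p∤n (d∣p , d∣n) with prime⇒irreducible pp d∣p
... | inj₁ d≡1      = d≡1
... | inj₂ d≡p@refl = contradiction d∣n p∤n

coprime-* : ∀ {m n o} → Coprime m n → Coprime m o → Coprime m (n * o)
coprime-* {o = o} m⊥n m⊥o (d∣m , d∣n*o) =
  m⊥o (d∣m , coprime-factors m⊥n (∣-trans d∣m (m∣m*n o) , d∣n*o))

todaPrime-* : ∀ {n p} c → Coprime p c → TodaPrime n p → TodaPrime (c * n) p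
todaPrime-* {n} {p} c p⊥c (pp , 2∤p , _ , k , 4n≡[p-1]k , p⊥k) =
  pp , 2∤p , subst ((p ∸ 1) ∣_) (sym 4cn≡[p-1]ck) (m∣m*n (c * k)) ,
  c * k , 4cn≡[p-1]ck , coprime-* p⊥c p⊥k
  where
  open ≡-Reasoning
  4cn≡[p-1]ck : 4 * (c * n) ≡ (p ∸ 1) * (c * k)
  4cn≡[p-1]ck = begin
    4 * (c * n)       ≡⟨ x∙yz≈y∙xz 4 c n ⟩
    c * (4 * n)       ≡⟨ cong (c *_) 4n≡[p-1]k ⟩
    c * ((p ∸ 1) * k) ≡⟨ x∙yz≈y∙xz c (p ∸ 1) k ⟩
    (p ∸ 1) * (c * k) ∎

corollary2p6 : (n : ℕ) → 0 < n → (p : ℕ) → TodaPrime n p → TodaPrime (2 * n) p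
corollary2p6 n _ p t@(_ , 2∤p , _) =
  todaPrime-* {n} 2 (coprime-sym (prime∤⇒coprime prime[2] 2∤p)) t
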